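{- Let $p$ be a prime, $q$ a power of $p$, and $n\ge 0$ an integer. Assume $F_n(1,x)$ is a permutation polynomial of $\mathbb{F}_q$. If $p=2$, then $3\mid n$. If $p$ is odd, then $n\not\equiv 1,2\pmod 6$.
   Context: For an integer $n\ge 1$, the $n$-th reversed Dickson polynomial of the third kind is $F_n(a,x)=\sum_{i=0}^{\lfloor n/2\rfloor}\frac{n-2i}{n-i}\binom{n-i}{i}(-x)^i a^{n-2i}$, where the coefficients $\frac{n-2i}{n-i}\binom{n-i}{i}=\binom{n-i}{i}-\binom{n-i-1}{i-1}$ (with $\binom{m}{ -1}=0$) are integers, read in $\mathbb{F}_q$; and $F_0(a,x)=0$. A polynomial $f\in\mathbb{F}_q[x]$ is a permutation polynomial of $\mathbb{F}_q$ if $c\mapsto f(c)$ is a bijection of $\mathbb{F}_q$. -}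

module Defs where

open import Level using (Level; _⊔_)
open import Data.Nat as ℕ using (ℕ; zero; suc; _∸_; _/_)
open import Data.Nat.Combinatorics using (_C_)
open import Data.Fin using (Fin)
open import Data.Product using (∃)
open import Relation.Binary.PropositionalEquality using (_≡_)
open import Relation.Nullary using (¬_)
open import Function.Definitions using (Bijective)
open import Algebra.Bundles using (CommutativeRing; Semiring)
import Algebra.Definitions.RawSemiring as RS

record IsFiniteField {c ℓ : Level} (R : CommutativeRing c ℓ) (q : ℕ) : Set (c ⊔ ℓ) where
  open CommutativeRing R
  field
    nontrivial : ¬ (1# ≈ 0#)
    inverse    : ∀ x → ¬ (x ≈ 0#) → ∃ λ y → x * y ≈ 1#
    enum       : Fin q → Carrier
    enum-bij   : Bijective _≡_ _≈_ enum

-- Integer coefficient of (-x)^i a^(n-2i) in F_n(a,x), for n ≥ 1 and i ≤ ⌊n/2⌋: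
--   binom(n-i, i) - binom(n-i-1, i-1)   (with binom(m,-1) = 0).
-- In this range the value is nonnegative, so truncated subtraction is exact.
coeff : ℕ → ℕ → ℕ
coeff n zero    = 1
coeff n (suc i) = ((n ∸ suc i) C suc i) ∸ ((n ∸ suc i ∸ 1) C i)

module _ {c ℓ : Level} (R : CommutativeRing c ℓ) where
  open CommutativeRing R
  open RS (Semiring.rawSemiring semiring) using (_×_; _^_)

  sumTo : ℕ → (ℕ → Carrier) → Carrier
  sumTo zero    g = g 0
  sumTo (suc m) g = sumTo m g + g (suc m)

  -- Reversed Dickson polynomial of the third kind, evaluated at a = 1 and x = c:
  --   F_n(1,c) = Σ_{i=0}^{⌊n/2⌋} coeff n i · (-c)^i ,  F_0(1,c) = 0.
  F₁ : ℕ → Carrier → Carrier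
  F₁ zero    x = 0#
  F₁ (suc n) x = sumTo (suc n / 2) (λ i → coeff (suc n) i × ((- x) ^ i))

  IsPermutation : (Carrier → Carrier) → Set (c ⊔ ℓ)
  IsPermutation f = Bijective _≈_ _≈_ f

  HasChar : ℕ → Set ℓ
  HasChar p = (p × 1#) ≈ 0#

module Submission where

-- F_n(1,x) takes the value 1 at x = 0 (n ≥ 1), so a permutation
-- F_n(1,·) must satisfy F_n(1,1) ≠ 1.  On the other hand
--   F_{m+1}(1,x) = A_{-x}(m),   A_y(m) = Σ_i C(m-i,i) y^i ,
-- and A_y obeys the Fibonacci-type recurrence A_y(m+2) = A_y(m+1) + y·A_y(m).
-- For y = -1 this gives A(m+3) = -A(m), hence n ↦ F_n(1,1) is 6-periodic
-- with values 0, 1, 1, 0, -1, -1 on n = 0,…,5.  So n ≡ 1, 2 (mod 6) is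
-- excluded in every characteristic, and in characteristic 2 (where -1 = 1)
-- also n ≡ 4, 5, which leaves exactly the residues 0 and 3, i.e. 3 ∣ n.

open import Defs
open import Level using (Level)
open import Data.Nat using (ℕ; _^_; _%_)
open import Data.Nat.Divisibility using (_∣_)
open import Data.Nat.Primality using (Prime)
open import Data.Product using (∃; _×_)
open import Relation.Binary.PropositionalEquality using (_≡_; _≢_)
open import Algebra.Bundles using (CommutativeRing)

open import Data.Nat as ℕ using (zero; suc; _∸_; _/_; _<_; _≤_; s≤s; z≤n)
open import Data.Nat.Properties using (≤-trans; n≤1+n; m≤m+n; m≤n⇒m<n∨m≡n)
open import Data.Nat.Divisibility using (divides; ∣n∣m%n⇒∣m)
open import Data.Nat.Combinatorics using (_C_)
open import Data.Nat.DivMod using (m%n<n)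
open import Data.Product using (_,_)
open import Data.Sum using (inj₁; inj₂)
open import Relation.Nullary using (¬_)
import Relation.Binary.PropositionalEquality as Eq
import Algebra.Definitions.RawSemiring as RawSemiringDefs
import Algebra.Properties.Ring as RingProperties
import Algebra.Properties.Semiring.Mult as SemiringMult
import Algebra.Properties.CommutativeSemigroup as CommutativeSemigroupProperties
import Relation.Binary.Reasoning.Setoid as SetoidReasoning

module Arithmetic where
  open import Data.Nat using (_+_; _*_)
  open import Relation.Binary.PropositionalEquality using (refl; sym; trans; cong; module ≡-Reasoning)
  open import Data.Nat.Properties
    using (+-comm; ≤-refl; <⇒≤; n<1+n; +-monoˡ-<; *-monoˡ-≤; *-comm; +-identityʳ
          ; 0∸n≡0; ∸-+-assoc; m+n∸m≡n; m<n+o⇒m∸n<o; module ≤-Reasoning)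
  open import Data.Nat.DivMod using (m≡m%n+[m/n]*n; m%n<n; m/n<m)
  open import Data.Nat.Divisibility using (∣-refl; _∣0)
  open import Data.Nat.Combinatorics using (nCk+nC[k+1]≡[n+1]C[k+1]; k>n⇒nCk≡0)
  open import Relation.Nullary using (contradiction)

  pascal-difference : ∀ t j → t C suc j ∸ (t ∸ 1) C j ≡ (t ∸ 1) C suc j
  pascal-difference zero    j = 0∸n≡0 (0 C j)
  pascal-difference (suc u) j = begin
    suc u C suc j ∸ u C j           ≡⟨ cong (_∸ u C j) (sym (nCk+nC[k+1]≡[n+1]C[k+1] u j)) ⟩
    u C j + u C suc j ∸ u C j       ≡⟨ m+n∸m≡n (u C j) (u C suc j) ⟩
    u C suc j                       ∎
    where open ≡-Reasoning

  coeff-binomial : ∀ m i → coeff (suc m) i ≡ (m ∸ i) C i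
  coeff-binomial m zero    = refl
  coeff-binomial m (suc j) = begin
    (m ∸ j) C suc j ∸ (m ∸ j ∸ 1) C j   ≡⟨ pascal-difference (m ∸ j) j ⟩
    (m ∸ j ∸ 1) C suc j                 ≡⟨ cong (_C suc j) m∸j∸1≡m∸[1+j] ⟩
    (m ∸ suc j) C suc j                 ∎
    where
    open ≡-Reasoning
    m∸j∸1≡m∸[1+j] : m ∸ j ∸ 1 ≡ m ∸ suc j
    m∸j∸1≡m∸[1+j] = trans (∸-+-assoc m j 1) (cong (m ∸_) (+-comm j 1))

  pascal-antidiagonal : ∀ n j → (suc n ∸ j) C suc j ≡ (n ∸ j) C suc j + (n ∸ j) C j
  pascal-antidiagonal n j = shifted n j j ≤-refl
    where
    -- generalised to a lower index k ≥ j, so that n and j can decrease together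
    shifted : ∀ n j k → j ≤ k → (suc n ∸ j) C suc k ≡ (n ∸ j) C suc k + (n ∸ j) C k
    shifted n       zero    k _ = trans (sym (nCk+nC[k+1]≡[n+1]C[k+1] n k)) (+-comm (n C k) (n C suc k))
    shifted zero    (suc j) (suc k) _ rewrite 0∸n≡0 j = refl
    shifted (suc n) (suc j) k j<k = shifted n j k (<⇒≤ j<k)

  antidiagonal-vanishes : ∀ m i → m < i + i → (m ∸ i) C i ≡ 0
  antidiagonal-vanishes m (suc i) m<2i = k>n⇒nCk≡0 (m<n+o⇒m∸n<o m (suc i) m<2i)

  beyond-half : ∀ n i → suc n / 2 < i → n < i + i
  beyond-half n i h<i = begin-strict
    n                         <⟨ n<1+n n ⟩
    suc n                     ≡⟨ m≡m%n+[m/n]*n (suc n) 2 ⟩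
    suc n % 2 + h * 2         <⟨ +-monoˡ-< (h * 2) (m%n<n (suc n) 2) ⟩
    suc h * 2                 ≤⟨ *-monoˡ-≤ 2 h<i ⟩
    i * 2                     ≡⟨ trans (*-comm i 2) (cong (i +_) (+-identityʳ i)) ⟩
    i + i                     ∎
    where
    open ≤-Reasoning
    h = suc n / 2

  half≤ : ∀ n → suc n / 2 ≤ n
  half≤ n with m/n<m (suc n) 2 (s≤s (s≤s z≤n))
  ... | s≤s h≤n = h≤n

  m≡[m/n]*n+m%n : ∀ m n .{{_ : ℕ.NonZero n}} → m ≡ (m / n) * n + m % n
  m≡[m/n]*n+m%n m n = trans (m≡m%n+[m/n]*n m n) (+-comm (m % n) ((m / n) * n))

  three-divides-residue : ∀ r → r < 6 → r ≢ 1 → r ≢ 2 → r ≢ 4 → r ≢ 5 → 3 ∣ r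
  three-divides-residue 0 _ _ _ _ _ = 3 ∣0
  three-divides-residue 1 _ r≢1 _ _ _ = contradiction refl r≢1
  three-divides-residue 2 _ _ r≢2 _ _ = contradiction refl r≢2
  three-divides-residue 3 _ _ _ _ _ = ∣-refl
  three-divides-residue 4 _ _ _ r≢4 _ = contradiction refl r≢4
  three-divides-residue 5 _ _ _ _ r≢5 = contradiction refl r≢5
  three-divides-residue (suc (suc (suc (suc (suc (suc r)))))) (s≤s (s≤s (s≤s (s≤s (s≤s (s≤s ())))))) _ _ _ _

open Arithmetic

module _ {c ℓ : Level} (R : CommutativeRing c ℓ) where
  open CommutativeRing R
  open RawSemiringDefs (Algebra.Bundles.Semiring.rawSemiring semiring)
    using () renaming (_×_ to _·_; _^_ to _^ᴿ_)
  open SemiringMult semiring using (×-congˡ; ×-congʳ; ×-homo-+; ×-comm-*)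
  open RingProperties ring using (-1*x≈-x; -0#≈0#; -‿involutive; xyx⁻¹≈y; +-inverseˡ-unique)
  open CommutativeSemigroupProperties +-commutativeSemigroup using (interchange)
  open SetoidReasoning setoid

  S : ℕ → (ℕ → Carrier) → Carrier
  S = sumTo R

  S-cong : ∀ m {g h} → (∀ i → g i ≈ h i) → S m g ≈ S m h
  S-cong zero    g≈h = g≈h 0
  S-cong (suc m) g≈h = +-cong (S-cong m g≈h) (g≈h (suc m))

  S-shift : ∀ m g → S (suc m) g ≈ g 0 + S m (λ i → g (suc i))
  S-shift zero    g = refl
  S-shift (suc m) g = trans (+-congʳ (S-shift m g)) (+-assoc _ _ _)

  S-+ : ∀ m g h → S m (λ i → g i + h i) ≈ S m g + S m h
  S-+ zero    g h = refl
  S-+ (suc m) g h = trans (+-congʳ (S-+ m g h)) (interchange _ _ _ _)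

  S-* : ∀ m y g → S m (λ i → y * g i) ≈ y * S m g
  S-* zero    y g = refl
  S-* (suc m) y g = trans (+-congʳ (S-* m y g)) (sym (distribˡ y _ _))

  S-vanishing-tail : ∀ m g → (∀ i → m < i → g i ≈ 0#) → ∀ {k} → m ≤ k → S m g ≈ S k g
  S-vanishing-tail m g vanish {zero} z≤n = refl
  S-vanishing-tail m g vanish {suc k} m≤k with m≤n⇒m<n∨m≡n m≤k
  ... | inj₂ Eq.refl     = refl
  ... | inj₁ (s≤s m≤k′) = begin
    S m g                   ≈⟨ S-vanishing-tail m g vanish m≤k′ ⟩
    S k g                   ≈⟨ +-identityʳ _ ⟨
    S k g + 0#              ≈⟨ +-congˡ (vanish (suc k) (s≤s m≤k′)) ⟨
    S k g + g (suc k)       ∎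

  module Antidiagonal (y : Carrier) where

    term : ℕ → ℕ → Carrier
    term m i = ((m ∸ i) C i) · (y ^ᴿ i)

    A : ℕ → Carrier
    A m = S m (term m)

    term-vanishes : ∀ m i → m < i ℕ.+ i → term m i ≈ 0#
    term-vanishes m i m<2i rewrite antidiagonal-vanishes m i m<2i = refl

    A-extend : ∀ m {k} → m ≤ k → A m ≈ S k (term m)
    A-extend m = S-vanishing-tail m (term m)
      (λ i m<i → term-vanishes m i (≤-trans m<i (m≤m+n i i)))

    term-pascal : ∀ m j → term (suc (suc m)) (suc j) ≈ term (suc m) (suc j) + y * term m j
    term-pascal m j = begin
      ((suc m ∸ j) C suc j) · (y * y ^ᴿ j)
        ≈⟨ ×-congˡ (pascal-antidiagonal m j) ⟩
      ((m ∸ j) C suc j ℕ.+ (m ∸ j) C j) · (y * y ^ᴿ j)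
        ≈⟨ ×-homo-+ (y * y ^ᴿ j) ((m ∸ j) C suc j) ((m ∸ j) C j) ⟩
      term (suc m) (suc j) + ((m ∸ j) C j) · (y * y ^ᴿ j)
        ≈⟨ +-congˡ (×-comm-* ((m ∸ j) C j) y (y ^ᴿ j)) ⟨
      term (suc m) (suc j) + y * term m j ∎

    A-rec : ∀ m → A (suc (suc m)) ≈ A (suc m) + y * A m
    A-rec m = begin
      A (suc (suc m))
        ≈⟨ S-shift (suc m) (term (suc (suc m))) ⟩
      term (suc m) 0 + S (suc m) (λ j → term (suc (suc m)) (suc j))
        ≈⟨ +-congˡ (S-cong (suc m) (term-pascal m)) ⟩
      term (suc m) 0 + S (suc m) (λ j → term (suc m) (suc j) + y * term m j)
        ≈⟨ +-congˡ (S-+ (suc m) (λ j → term (suc m) (suc j)) (λ j → y * term m j)) ⟩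
      term (suc m) 0 + (S (suc m) (λ j → term (suc m) (suc j)) + S (suc m) (λ j → y * term m j))
        ≈⟨ +-assoc _ _ _ ⟨
      (term (suc m) 0 + S (suc m) (λ j → term (suc m) (suc j))) + S (suc m) (λ j → y * term m j)
        ≈⟨ +-cong (sym (S-shift (suc m) (term (suc m)))) (S-* (suc m) y (term m)) ⟩
      S (suc (suc m)) (term (suc m)) + y * S (suc m) (term m)
        ≈⟨ +-cong (A-extend (suc m) (n≤1+n (suc m))) (*-congˡ (A-extend m (n≤1+n m))) ⟨
      A (suc m) + y * A m ∎

  open Antidiagonal using (A; term; term-vanishes; A-rec)

  F₁-antidiagonal : ∀ n x → F₁ R (suc n) x ≈ A (- x) n
  F₁-antidiagonal n x = begin
    F₁ R (suc n) x
      ≈⟨ S-cong h (λ i → ×-congˡ (coeff-binomial n i)) ⟩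
    S h (term (- x) n)
      ≈⟨ S-vanishing-tail h (term (- x) n) (λ i h<i → term-vanishes (- x) n i (beyond-half n i h<i)) (half≤ n) ⟩
    A (- x) n ∎
    where h = suc n / 2

  F₁-at-0 : ∀ n → F₁ R (suc n) 0# ≈ 1#
  F₁-at-0 n = begin
    F₁ R (suc n) 0#  ≈⟨ S-vanishing-tail 0 g g-vanishes {suc n / 2} z≤n ⟨
    g 0              ≈⟨ +-identityʳ 1# ⟩
    1#               ∎
    where
    g : ℕ → Carrier
    g i = coeff (suc n) i · ((- 0#) ^ᴿ i)
    g-vanishes : ∀ i → 0 < i → g i ≈ 0#
    g-vanishes (suc i) _ = begin
      coeff (suc n) (suc i) · (- 0# * (- 0#) ^ᴿ i)  ≈⟨ ×-congʳ (coeff (suc n) (suc i)) (*-congʳ -0#≈0#) ⟩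
      coeff (suc n) (suc i) · (0# * (- 0#) ^ᴿ i)    ≈⟨ ×-comm-* (coeff (suc n) (suc i)) 0# _ ⟨
      0# * (coeff (suc n) (suc i) · (- 0#) ^ᴿ i)    ≈⟨ zeroˡ _ ⟩
      0#                                              ∎

  open Antidiagonal (- 1#) using () renaming (A to A₋₁)

  A₋₁-antiperiodic : ∀ m → A₋₁ (suc (suc (suc m))) ≈ - A₋₁ m
  A₋₁-antiperiodic m = begin
    A₋₁ (suc (suc (suc m)))                        ≈⟨ A-rec (- 1#) (suc m) ⟩
    A₋₁ (suc (suc m)) + - 1# * A₋₁ (suc m)         ≈⟨ +-cong (A-rec (- 1#) m) (-1*x≈-x _) ⟩
    (A₋₁ (suc m) + - 1# * A₋₁ m) + - A₋₁ (suc m)   ≈⟨ xyx⁻¹≈y _ _ ⟩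
    - 1# * A₋₁ m                                   ≈⟨ -1*x≈-x _ ⟩
    - A₋₁ m                                        ∎

  F₁-1-at-1 : F₁ R 1 1# ≈ 1#
  F₁-1-at-1 = +-identityʳ 1#

  F₁-2-at-1 : F₁ R 2 1# ≈ 1#
  F₁-2-at-1 = trans (+-identityʳ _) (+-identityʳ 1#)

  F₁-3-at-1 : F₁ R 3 1# ≈ 0#
  F₁-3-at-1 = trans (+-cong (+-identityʳ 1#) (trans (+-identityʳ _) (*-identityʳ (- 1#))))
                    (-‿inverseʳ 1#)

  F₁-at-1-antiperiodic : ∀ n → F₁ R (suc (suc (suc n))) 1# ≈ - F₁ R n 1#
  F₁-at-1-antiperiodic zero    = trans F₁-3-at-1 (sym -0#≈0#)
  F₁-at-1-antiperiodic (suc m) = begin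
    F₁ R (suc (suc (suc (suc m)))) 1#   ≈⟨ F₁-antidiagonal (suc (suc (suc m))) 1# ⟩
    A₋₁ (suc (suc (suc m)))             ≈⟨ A₋₁-antiperiodic m ⟩
    - A₋₁ m                             ≈⟨ -‿cong (F₁-antidiagonal m 1#) ⟨
    - F₁ R (suc m) 1#                   ∎

  F₁-4-at-1 : F₁ R 4 1# ≈ - 1#
  F₁-4-at-1 = trans (F₁-at-1-antiperiodic 1) (-‿cong F₁-1-at-1)

  F₁-5-at-1 : F₁ R 5 1# ≈ - 1#
  F₁-5-at-1 = trans (F₁-at-1-antiperiodic 2) (-‿cong F₁-2-at-1)

  F₁-at-1-mod-6 : ∀ n → F₁ R n 1# ≈ F₁ R (n % 6) 1#
  F₁-at-1-mod-6 n = trans (reflexive (Eq.cong (λ t → F₁ R t 1#) (m≡[m/n]*n+m%n n 6)))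
                          (multiples (n / 6) (n % 6))
    where
    period-6 : ∀ n → F₁ R (6 ℕ.+ n) 1# ≈ F₁ R n 1#
    period-6 n = trans (F₁-at-1-antiperiodic (3 ℕ.+ n))
                       (trans (-‿cong (F₁-at-1-antiperiodic n)) (-‿involutive _))
    multiples : ∀ k r → F₁ R (k ℕ.* 6 ℕ.+ r) 1# ≈ F₁ R r 1#
    multiples zero    r = refl
    multiples (suc k) r = trans (period-6 (k ℕ.* 6 ℕ.+ r)) (multiples k r)

  char-2⇒-1≈1 : HasChar R 2 → - 1# ≈ 1#
  char-2⇒-1≈1 2·1≈0 = sym (+-inverseˡ-unique 1# 1# (trans (+-congˡ (sym (+-identityʳ 1#))) 2·1≈0))

  -- The collision: F_n(1,0) = 1 for n ≥ 1 and F_0 = 0 ≠ 1, so a permutation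
  -- polynomial F_n(1,·) over a nontrivial ring cannot satisfy F_n(1,1) = 1.
  permutation⇒F₁-at-1≉1 : ¬ (1# ≈ 0#) → ∀ n → IsPermutation R (F₁ R n) → ¬ (F₁ R n 1# ≈ 1#)
  permutation⇒F₁-at-1≉1 1≉0 zero    _               F₀≈1 = 1≉0 (sym F₀≈1)
  permutation⇒F₁-at-1≉1 1≉0 (suc n) (injective , _) F≈1  = 1≉0 (injective (trans F≈1 (sym (F₁-at-0 n))))

theorem3p1 : ∀ {c ℓ : Level} (R : CommutativeRing c ℓ) (p q n : ℕ) →
    Prime p → (∃ λ k → q ≡ p ^ k) → IsFiniteField R q → HasChar R p →
    IsPermutation R (F₁ R n) →
    (p ≡ 2 → 3 ∣ n) × (p ≢ 2 → (n % 6 ≢ 1) × (n % 6 ≢ 2))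
theorem3p1 R p q n _ _ finite charP perm = char-2 , odd-char
  where
  open CommutativeRing R using (_≈_; 1#; -_; trans; reflexive)
  open IsFiniteField finite using (nontrivial)

  excluded : ∀ r → F₁ R r 1# ≈ 1# → n % 6 ≢ r
  excluded r F₁-r≈1 n%6≡r = permutation⇒F₁-at-1≉1 R nontrivial n perm
    (trans (F₁-at-1-mod-6 R n) (trans (reflexive (Eq.cong (λ t → F₁ R t 1#) n%6≡r)) F₁-r≈1))

  char-2 : p ≡ 2 → 3 ∣ n
  char-2 p≡2 = ∣n∣m%n⇒∣m (divides 2 Eq.refl)
    (three-divides-residue (n % 6) (m%n<n n 6) (excluded 1 (F₁-1-at-1 R)) (excluded 2 (F₁-2-at-1 R))
      (excluded 4 (trans (F₁-4-at-1 R) -1≈1)) (excluded 5 (trans (F₁-5-at-1 R) -1≈1)))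
    where
    -1≈1 : - 1# ≈ 1#
    -1≈1 = char-2⇒-1≈1 R (Eq.subst (HasChar R) p≡2 charP)

  odd-char : p ≢ 2 → (n % 6 ≢ 1) × (n % 6 ≢ 2)
  odd-char _ = excluded 1 (F₁-1-at-1 R) , excluded 2 (F₁-2-at-1 R)
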